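{- The following hold in any $C$-algebra $M$ with $T, F, U$ (for $a, b \in M$ and $A, B \subseteq M$): \begin{enumerate}[\rm(i)] \item $Ann(U) = M$. \item For any $a \in M$, $U \in Ann(a)$. \item For any $a \in M_{\#}$, $Ann(a) = \{ U \}$. \item $Ann(M) = \{ U \}$. \item $b \in Ann(a) \Leftrightarrow a \in Ann(b)$. \item $B \subseteq Ann(A) \Leftrightarrow A \subseteq Ann(B)$. \item $A \subseteq B \Rightarrow Ann(B) \subseteq Ann(A)$. \end{enumerate}
   Context: A $C$-algebra is an algebra $\langle M, \vee, \wedge, \neg \rangle$ of type $(2,2,1)$ satisfying the Guzmán–Squier axioms for McCarthy's three-valued (left-sequential) logic; every $C$-algebra embeds in $\mathbb{3}^{X}$ for some set $X$, where $\mathbb{3} = \{T, F, U\}$ with McCarthy's operations ($\neg T = F$, $\neg F = T$, $\neg U = U$; $T \wedge y = y$, $F \wedge y = F$, $U \wedge y = U$; $T \vee y = T$, $F \vee y = y$, $U \vee y = U$), operations on $\mathbb{3}^X$ pointwise. A $C$-algebra with $T, F, U$ has nullary operations $T$ (identity for $\wedge$), $F$ (identity for $\vee$), $U$ (fixed point of $\neg$). $M_{\#} = \{ \alpha \in M : \alpha \vee \neg \alpha = T \}$. For $a \in M$, $Ann(a) = \{ \alpha \in M : (\alpha \wedge a) \vee (\neg \alpha \wedge a) = U \}$ (this comes from the if-then-else action $\alpha[\beta,\gamma] = (\alpha \wedge \beta) \vee (\neg \alpha \wedge \gamma)$ of $M$ on itself); for $S \subseteq M$, $Ann(S) = \bigcap_{a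 \in S} Ann(a)$. $Ann(U)$ means $Ann(\{U\})$. -}

module Defs where

open import Level using (0ℓ)
open import Relation.Binary.PropositionalEquality using (_≡_)
open import Relation.Unary using (Pred; _∈_)

-- C-algebra (Guzmán–Squier axioms for McCarthy's left-sequential
-- three-valued logic) with nullary operations T, F, U.
record CAlgebraTFU : Set₁ where
  infixr 6 _∧_
  infixr 5 _∨_
  field
    Carrier : Set
    _∨_     : Carrier → Carrier → Carrier
    _∧_     : Carrier → Carrier → Carrier
    ¬_      : Carrier → Carrier
    T F U   : Carrier
    C1 : ∀ x → ¬ (¬ x) ≡ x
    C2 : ∀ x y → ¬ (x ∧ y) ≡ (¬ x) ∨ (¬ y)
    C3 : ∀ x y z → (x ∧ y) ∧ z ≡ x ∧ (y ∧ z)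
    C4 : ∀ x y z → x ∧ (y ∨ z) ≡ (x ∧ y) ∨ (x ∧ z)
    C5 : ∀ x y z → (x ∨ y) ∧ z ≡ (x ∧ z) ∨ ((¬ x) ∧ (y ∧ z))
    C6 : ∀ x y → x ∨ (x ∧ y) ≡ x
    C7 : ∀ x y → (x ∧ y) ∨ (y ∧ x) ≡ (y ∧ x) ∨ (x ∧ y)
    T-identityˡ : ∀ x → T ∧ x ≡ x
    T-identityʳ : ∀ x → x ∧ T ≡ x
    F-identityˡ : ∀ x → F ∨ x ≡ x
    F-identityʳ : ∀ x → x ∨ F ≡ x
    ¬U : ¬ U ≡ U

  M# : Pred Carrier 0ℓ
  M# α = α ∨ (¬ α) ≡ T

  ite : Carrier → Carrier → Carrier → Carrier
  ite α β γ = (α ∧ β) ∨ ((¬ α) ∧ γ)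

  Ann : Carrier → Pred Carrier 0ℓ
  Ann a α = ite α a a ≡ U

  AnnS : Pred Carrier 0ℓ → Pred Carrier 0ℓ
  AnnS S α = ∀ a → a ∈ S → α ∈ Ann a

module Submission where

-- Write  δ x = x ∨ T  for the "definedness" of x (in 𝟛^X it
-- is T where x is defined and U where x is U).  Axiom (C5) turns the
-- diagonal if-then-else into a product:  α[a,a] = δ α ∧ a, so
--     α ∈ Ann a   ⇔   δ α ∧ a = U.
-- After deriving the elementary laws (U is absorbing on the left, ∨ is
-- associative, δ x ∧ x = x, x ∨ ¬x = δ x, δ x absorbs anything joined on
-- its right) we show that δ b ∧ a = U forces δ b ∧ δ a = U, and that a
-- product of two definedness elements vanishes in one order iff in the
-- other (this is where (C7) enters).  Together these give the symmetry
-- b ∈ Ann a ⇔ a ∈ Ann b, which is the heart of the proposition: (ii) is a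
-- computation, (i) is (ii) read backwards, (iii) uses δ a = T, (iv) is
-- (iii) for a = T, and (vi), (vii) are the Galois-connection properties of
-- the polar maps of any symmetric relation.

open import Defs
open import Data.Product using (_×_; _,_; proj₁)
open import Function.Bundles using (_⇔_; mk⇔; module Equivalence)
open import Relation.Unary using (Pred; _∈_; _⊆_; _≐_; ｛_｝; Universal)
open import Level using (0ℓ)
open import Relation.Binary.PropositionalEquality
  using (_≡_; refl; sym; trans; cong; module ≡-Reasoning)

module Annihilators (M : CAlgebraTFU) where
  open CAlgebraTFU M
  open ≡-Reasoning

  ¬-injective : ∀ {x y} → ¬ x ≡ ¬ y → x ≡ y
  ¬-injective {x} {y} eq = trans (sym (C1 x)) (trans (cong ¬_ eq) (C1 y))

  ¬-∨ : ∀ x y → ¬ (x ∨ y) ≡ ¬ x ∧ ¬ y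
  ¬-∨ x y = ¬-injective (begin
    ¬ (¬ (x ∨ y))         ≡⟨ C1 (x ∨ y) ⟩
    x ∨ y                 ≡⟨ cong (λ h → h ∨ y) (sym (C1 x)) ⟩
    ¬ (¬ x) ∨ y           ≡⟨ cong (λ h → ¬ (¬ x) ∨ h) (sym (C1 y)) ⟩
    ¬ (¬ x) ∨ ¬ (¬ y)     ≡⟨ sym (C2 (¬ x) (¬ y)) ⟩
    ¬ (¬ x ∧ ¬ y)         ∎)

  ∨-assoc : ∀ x y z → (x ∨ y) ∨ z ≡ x ∨ (y ∨ z)
  ∨-assoc x y z = ¬-injective (begin
    ¬ ((x ∨ y) ∨ z)       ≡⟨ ¬-∨ (x ∨ y) z ⟩
    ¬ (x ∨ y) ∧ ¬ z       ≡⟨ cong (_∧ ¬ z) (¬-∨ x y) ⟩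
    (¬ x ∧ ¬ y) ∧ ¬ z     ≡⟨ C3 (¬ x) (¬ y) (¬ z) ⟩
    ¬ x ∧ (¬ y ∧ ¬ z)     ≡⟨ cong (¬ x ∧_) (sym (¬-∨ y z)) ⟩
    ¬ x ∧ ¬ (y ∨ z)       ≡⟨ sym (¬-∨ x (y ∨ z)) ⟩
    ¬ (x ∨ (y ∨ z))       ∎)

  ∨-idem : ∀ x → x ∨ x ≡ x
  ∨-idem x = trans (cong (x ∨_) (sym (T-identityʳ x))) (C6 x T)

  ∧-idem : ∀ x → x ∧ x ≡ x
  ∧-idem x = ¬-injective (trans (C2 x x) (∨-idem (¬ x)))

  T-zeroˡ : ∀ x → T ∨ x ≡ T
  T-zeroˡ x = trans (cong (T ∨_) (sym (T-identityˡ x))) (C6 T x)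

  ¬T≡F : ¬ T ≡ F
  ¬T≡F = begin
    ¬ T                   ≡⟨ sym (F-identityˡ (¬ T)) ⟩
    F ∨ ¬ T               ≡⟨ cong (λ h → h ∨ ¬ T) (sym (C1 F)) ⟩
    ¬ (¬ F) ∨ ¬ T         ≡⟨ sym (C2 (¬ F) T) ⟩
    ¬ (¬ F ∧ T)           ≡⟨ cong ¬_ (T-identityʳ (¬ F)) ⟩
    ¬ (¬ F)               ≡⟨ C1 F ⟩
    F                     ∎

  U∨T≡U : U ∨ T ≡ U
  U∨T≡U = begin
    U ∨ T                 ≡⟨ sym (T-identityʳ (U ∨ T)) ⟩
    (U ∨ T) ∧ T           ≡⟨ C5 U T T ⟩
    U ∧ T ∨ ¬ U ∧ (T ∧ T) ≡⟨ cong (λ h → U ∧ T ∨ h ∧ (T ∧ T)) ¬U ⟩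
    U ∧ T ∨ U ∧ (T ∧ T)   ≡⟨ cong (λ h → U ∧ T ∨ U ∧ h) (T-identityʳ T) ⟩
    U ∧ T ∨ U ∧ T         ≡⟨ ∨-idem (U ∧ T) ⟩
    U ∧ T                 ≡⟨ T-identityʳ U ⟩
    U                     ∎

  U∧F≡U : U ∧ F ≡ U
  U∧F≡U = begin
    U ∧ F                 ≡⟨ cong (λ h → h ∧ F) (sym ¬U) ⟩
    ¬ U ∧ F               ≡⟨ cong (¬ U ∧_) (sym ¬T≡F) ⟩
    ¬ U ∧ ¬ T             ≡⟨ sym (¬-∨ U T) ⟩
    ¬ (U ∨ T)             ≡⟨ cong ¬_ U∨T≡U ⟩
    ¬ U                   ≡⟨ ¬U ⟩
    U                     ∎

  U-zeroˡ-∧ : ∀ x → U ∧ x ≡ U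
  U-zeroˡ-∧ x = begin
    U ∧ x                 ≡⟨ cong (U ∧_) (sym (F-identityˡ x)) ⟩
    U ∧ (F ∨ x)           ≡⟨ C4 U F x ⟩
    U ∧ F ∨ U ∧ x         ≡⟨ cong (λ h → h ∨ U ∧ x) U∧F≡U ⟩
    U ∨ U ∧ x             ≡⟨ C6 U x ⟩
    U                     ∎

  U-zeroˡ-∨ : ∀ x → U ∨ x ≡ U
  U-zeroˡ-∨ x = ¬-injective (begin
    ¬ (U ∨ x)             ≡⟨ ¬-∨ U x ⟩
    ¬ U ∧ ¬ x             ≡⟨ cong (_∧ ¬ x) ¬U ⟩
    U ∧ ¬ x               ≡⟨ U-zeroˡ-∧ (¬ x) ⟩
    U                     ≡⟨ sym ¬U ⟩
    ¬ U                   ∎)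

  -- Definedness of x: T where x is defined, U where it is not.
  δ : Carrier → Carrier
  δ x = x ∨ T

  -- (C5) with middle argument T: the diagonal if-then-else is a product.
  ite-diagonal : ∀ x y → ite x y y ≡ δ x ∧ y
  ite-diagonal x y = sym (begin
    (x ∨ T) ∧ y           ≡⟨ C5 x T y ⟩
    x ∧ y ∨ ¬ x ∧ (T ∧ y) ≡⟨ cong (λ h → x ∧ y ∨ ¬ x ∧ h) (T-identityˡ y) ⟩
    x ∧ y ∨ ¬ x ∧ y       ∎)

  Ann⇔δ : ∀ a α → α ∈ Ann a ⇔ (δ α ∧ a ≡ U)
  Ann⇔δ a α = mk⇔ (trans (sym (ite-diagonal α a))) (trans (ite-diagonal α a))

  -- The excluded-middle element x ∨ ¬x is the definedness of x;
  -- hence a ∈ M# says exactly δ a = T.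
  excluded-middle≡δ : ∀ x → x ∨ ¬ x ≡ δ x
  excluded-middle≡δ x = begin
    x ∨ ¬ x                   ≡⟨ cong (λ h → h ∨ ¬ x) (sym (T-identityʳ x)) ⟩
    x ∧ T ∨ ¬ x               ≡⟨ cong (x ∧ T ∨_) (sym (T-identityʳ (¬ x))) ⟩
    x ∧ T ∨ ¬ x ∧ T           ≡⟨ ite-diagonal x T ⟩
    δ x ∧ T                   ≡⟨ T-identityʳ (δ x) ⟩
    δ x                       ∎

  δ-restrict : ∀ x → δ x ∧ x ≡ x
  δ-restrict x = begin
    δ x ∧ x                   ≡⟨ sym (ite-diagonal x x) ⟩
    x ∧ x ∨ ¬ x ∧ x           ≡⟨ cong (λ h → h ∨ ¬ x ∧ x) (∧-idem x) ⟩
    x ∨ ¬ x ∧ x               ≡⟨ cong (λ h → h ∨ ¬ x ∧ h) (sym (T-identityʳ x)) ⟩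
    x ∧ T ∨ ¬ x ∧ (x ∧ T)     ≡⟨ sym (C5 x x T) ⟩
    (x ∨ x) ∧ T               ≡⟨ T-identityʳ (x ∨ x) ⟩
    x ∨ x                     ≡⟨ ∨-idem x ⟩
    x                         ∎

  δ-absorbs : ∀ x y → δ x ∨ y ≡ δ x
  δ-absorbs x y = trans (∨-assoc x T y) (cong (x ∨_) (T-zeroˡ y))

  δ∧δ-absorbs : ∀ x y z → (δ x ∧ δ y) ∨ z ≡ δ x ∧ δ y
  δ∧δ-absorbs x y z = begin
    δ x ∧ (y ∨ T) ∨ z               ≡⟨ cong (_∨ z) expand ⟩
    (δ x ∧ y ∨ δ x) ∨ z             ≡⟨ ∨-assoc (δ x ∧ y) (δ x) z ⟩
    δ x ∧ y ∨ (δ x ∨ z)             ≡⟨ cong (δ x ∧ y ∨_) (δ-absorbs x z) ⟩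
    δ x ∧ y ∨ δ x                   ≡⟨ sym expand ⟩
    δ x ∧ (y ∨ T)                   ∎
    where
    expand : δ x ∧ (y ∨ T) ≡ δ x ∧ y ∨ δ x
    expand = trans (C4 (δ x) y T) (cong (δ x ∧ y ∨_) (T-identityʳ (δ x)))

  δ-annihilates : ∀ a b → δ b ∧ a ≡ U → δ b ∧ δ a ≡ U
  δ-annihilates a b h = begin
    δ b ∧ (a ∨ T)             ≡⟨ C4 (δ b) a T ⟩
    δ b ∧ a ∨ δ b ∧ T         ≡⟨ cong (_∨ δ b ∧ T) h ⟩
    U ∨ δ b ∧ T               ≡⟨ U-zeroˡ-∨ (δ b ∧ T) ⟩
    U                         ∎

  δ∧δ-swap : ∀ a b → δ b ∧ δ a ≡ U → δ a ∧ δ b ≡ U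
  δ∧δ-swap a b h = begin
    δ a ∧ δ b                       ≡⟨ sym (δ∧δ-absorbs a b U) ⟩
    δ a ∧ δ b ∨ U                   ≡⟨ cong (δ a ∧ δ b ∨_) (sym h) ⟩
    δ a ∧ δ b ∨ δ b ∧ δ a           ≡⟨ C7 (δ a) (δ b) ⟩
    δ b ∧ δ a ∨ δ a ∧ δ b           ≡⟨ cong (_∨ δ a ∧ δ b) h ⟩
    U ∨ δ a ∧ δ b                   ≡⟨ U-zeroˡ-∨ (δ a ∧ δ b) ⟩
    U                               ∎

  Ann-sym : ∀ a b → b ∈ Ann a → a ∈ Ann b
  Ann-sym a b b∈Ann-a = Equivalence.from (Ann⇔δ b a) (begin
    δ a ∧ b                   ≡⟨ cong (δ a ∧_) (sym (δ-restrict b)) ⟩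
    δ a ∧ (δ b ∧ b)           ≡⟨ sym (C3 (δ a) (δ b) b) ⟩
    (δ a ∧ δ b) ∧ b           ≡⟨ cong (_∧ b) δa∧δb≡U ⟩
    U ∧ b                     ≡⟨ U-zeroˡ-∧ b ⟩
    U                         ∎)
    where
    δa∧δb≡U : δ a ∧ δ b ≡ U
    δa∧δb≡U = δ∧δ-swap a b
      (δ-annihilates a b (Equivalence.to (Ann⇔δ a b) b∈Ann-a))

  -- (ii) U annihilates everything, since δ U = U is absorbing.
  U∈Ann : ∀ a → U ∈ Ann a
  U∈Ann a = Equivalence.from (Ann⇔δ a U)
    (trans (cong (_∧ a) U∨T≡U) (U-zeroˡ-∧ a))

  δ-undefined : ∀ x → δ x ≡ U → x ≡ U
  δ-undefined x h = begin
    x                         ≡⟨ sym (δ-restrict x) ⟩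
    δ x ∧ x                   ≡⟨ cong (_∧ x) h ⟩
    U ∧ x                     ≡⟨ U-zeroˡ-∧ x ⟩
    U                         ∎

  Ann-of-M# : ∀ a → a ∈ M# → Ann a ≐ ｛ U ｝
  Ann-of-M# a a∈M# = only-U , λ { refl → U∈Ann a }
    where
    T≡δa : T ≡ δ a
    T≡δa = trans (sym a∈M#) (excluded-middle≡δ a)
    only-U : ∀ {α} → α ∈ Ann a → U ≡ α
    only-U {α} α∈Ann-a = sym (δ-undefined α (begin
      δ α                     ≡⟨ sym (T-identityʳ (δ α)) ⟩
      δ α ∧ T                 ≡⟨ cong (δ α ∧_) T≡δa ⟩
      δ α ∧ δ a               ≡⟨ δ-annihilates a α (Equivalence.to (Ann⇔δ a α) α∈Ann-a) ⟩
      U                       ∎))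

  -- (i) Everything annihilates U: this is (ii) read through symmetry.
  AnnS-｛U｝-universal : Universal (AnnS ｛ U ｝)
  AnnS-｛U｝-universal α _ refl = Ann-sym α U (U∈Ann α)

  -- (iv) Only U annihilates all of M; already Ann(T) = {U}, as T ∈ M#.
  AnnS-M : AnnS Relation.Unary.U ≐ ｛ U ｝
  AnnS-M = (λ α∈AnnM → proj₁ (Ann-of-M# T T∈M#) (α∈AnnM T _))
         , λ { refl a _ → U∈Ann a }
    where
    T∈M# : T ∈ M#
    T∈M# = T-zeroˡ (¬ T)

  -- (vi) Since annihilation is symmetric, the polar maps S ↦ Ann(S)
  -- form a Galois connection ...
  AnnS-galois : ∀ (A B : Pred Carrier 0ℓ) → B ⊆ AnnS A → A ⊆ AnnS B
  AnnS-galois A B B⊆AnnA {a} a∈A b b∈B = Ann-sym a b (B⊆AnnA b∈B a a∈A)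

  AnnS-antitone : ∀ (A B : Pred Carrier 0ℓ) → A ⊆ B → AnnS B ⊆ AnnS A
  AnnS-antitone A B A⊆B α∈AnnB a a∈A = α∈AnnB a (A⊆B a∈A)

proposition4p3 : (M : CAlgebraTFU) → let open CAlgebraTFU M in
    Universal (AnnS ｛ U ｝)
    × (∀ a → U ∈ Ann a)
    × (∀ a → a ∈ M# → Ann a ≐ ｛ U ｝)
    × (AnnS Relation.Unary.U ≐ ｛ U ｝)
    × (∀ a b → (b ∈ Ann a) ⇔ (a ∈ Ann b))
    × (∀ (A B : Pred Carrier 0ℓ) → (B ⊆ AnnS A) ⇔ (A ⊆ AnnS B))
    × (∀ (A B : Pred Carrier 0ℓ) → A ⊆ B → AnnS B ⊆ AnnS A)
proposition4p3 M =
    AnnS-｛U｝-universal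
  , U∈Ann
  , Ann-of-M#
  , AnnS-M
  , (λ a b → mk⇔ (Ann-sym a b) (Ann-sym b a))
  , (λ A B → mk⇔ (AnnS-galois A B) (AnnS-galois B A))
  , AnnS-antitone
  where open Annihilators M
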